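{- Let $G$ be a complete multi-partite graph and let $V_1,V_2$ be disjoint subsets of $V(G)$ with $V_2\ne\emptyset$. If $|V_1|\ge|V_2|$ and $V_1\cup V_2$ is not an independent set of $G$, then there exists a vertex $u\in V_2$ with $|N_G(u)\cap V_1|\ge|N_G(u)\cap V_2|$; moreover this inequality is strict when either $|V_1|>|V_2|$ or $\chi(G[V_2])<\chi(G[V_1\cup V_2])$.
   Context: $N_G(u)$ denotes the set of neighbors of $u$ in $G$; $G[U]$ is the subgraph induced by $U$; $\chi$ is the chromatic number. -}

module Defs where

open import Data.Nat using (ℕ; _≤_; _<_)
open import Data.Fin using (Fin)
open import Data.Fin.Subset using (Subset; _∈_; _∩_; _∪_; ∣_∣; Empty)
open import Data.Vec using (tabulate)
open import Data.Product using (_×_; ∃)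
open import Relation.Nullary using (¬_; Dec; does)
open import Relation.Binary.PropositionalEquality using (_≡_; _≢_)

record Graph (n : ℕ) : Set₁ where
  field
    Adj     : Fin n → Fin n → Set
    adj?    : ∀ u v → Dec (Adj u v)
    sym     : ∀ {u v} → Adj u v → Adj v u
    irrefl  : ∀ {u} → ¬ Adj u u
open Graph public

IsCompleteMultipartite : ∀ {n} → Graph n → Set
IsCompleteMultipartite {n} G =
  ∃ λ (part : Fin n → ℕ) → ∀ u v → (Adj G u v → part u ≢ part v) × (part u ≢ part v → Adj G u v)

N : ∀ {n} → Graph n → Fin n → Subset n
N G u = tabulate (λ v → does (adj? G u v))

Independent : ∀ {n} → Graph n → Subset n → Set
Independent G S = ∀ u v → u ∈ S → v ∈ S → ¬ Adj G u v

Colourable : ∀ {n} → Graph n → Subset n → ℕ → Set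
Colourable {n} G S k =
  ∃ λ (c : Fin n → Fin k) → ∀ u v → u ∈ S → v ∈ S → Adj G u v → c u ≢ c v

IsChromaticNumber : ∀ {n} → Graph n → Subset n → ℕ → Set
IsChromaticNumber G S k = Colourable G S k × (∀ m → Colourable G S m → k ≤ m)

ChromaticLess : ∀ {n} → Graph n → Subset n → Subset n → Set
ChromaticLess G S T =
  ∃ λ a → ∃ λ b → IsChromaticNumber G S a × IsChromaticNumber G T b × a < b

-- Write aᵢ, bᵢ for the number of vertices of V₁, V₂ in the i-th part and c = |V₁| − |V₂|.
-- A vertex of V₂ in part i has |V₂| − bᵢ neighbours in V₂ and |V₁| − aᵢ in V₁. If every
-- vertex of V₂ had more neighbours in V₂ than in V₁ (resp. at least as many), then
-- aᵢ ≥ bᵢ + c + 1 (resp. aᵢ ≥ bᵢ + c) on every part meeting V₂; summing over these parts,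
-- one part at a time, gives |V₁| ≥ |V₂| + c + 1, which is absurd. In the non-strict case
-- the sum instead forces: if c > 0, that V₂ meets a single part which also contains V₁,
-- so V₁ ∪ V₂ is independent; if c = 0, that every part meeting V₁ meets V₂, so colouring
-- each vertex like a vertex of V₂ in its part extends a colouring of G[V₂] to G[V₁ ∪ V₂].
module Submission where

open import Defs
open import Data.Nat using (ℕ; _≤_; _<_)
open import Data.Fin.Subset using (Subset; _∈_; _∩_; _∪_; ∣_∣; Empty; Nonempty)
open import Data.Product using (_×_; ∃)
open import Data.Sum using (_⊎_)
open import Relation.Nullary using (¬_)

open import Data.Nat using (zero; suc; _+_; z≤n; _≟_; _≤?_; _<?_)
open import Data.Nat.Properties
open import Data.Nat.Induction using (<-wellFounded)
open import Data.Nat.Solver using (module +-*-Solver)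
open import Data.Bool using (true; false)
open import Data.Empty using (⊥; ⊥-elim)
open import Data.Fin using (Fin)
open import Data.Fin.Properties using (any?)
open import Data.Fin.Subset using (∁; _⊆_; _⊂_; _-_)
open import Data.Fin.Subset.Properties
open import Data.Product using (_,_; proj₁; proj₂)
open import Data.Sum using (inj₁; inj₂)
open import Data.Vec using ([]; _∷_)
open import Data.Vec.Properties using (lookup∘tabulate; []=⇒lookup; lookup⇒[]=)
open import Function using (_∘_)
open import Induction.WellFounded using (Acc; acc)
open import Relation.Binary.PropositionalEquality as ≡ hiding (sym)
open import Relation.Nullary using (yes; no)
open import Relation.Nullary.Decidable using (dec-true; decidable-stable; _×-dec_)

∣q∣≡∣p∩q∣+∣∁p∩q∣ : ∀ {n} (p q : Subset n) → ∣ q ∣ ≡ ∣ p ∩ q ∣ + ∣ ∁ p ∩ q ∣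
∣q∣≡∣p∩q∣+∣∁p∩q∣ []          []          = refl
∣q∣≡∣p∩q∣+∣∁p∩q∣ (true  ∷ p) (true  ∷ q) = cong suc (∣q∣≡∣p∩q∣+∣∁p∩q∣ p q)
∣q∣≡∣p∩q∣+∣∁p∩q∣ (false ∷ p) (true  ∷ q) =
  trans (cong suc (∣q∣≡∣p∩q∣+∣∁p∩q∣ p q)) (≡.sym (+-suc _ _))
∣q∣≡∣p∩q∣+∣∁p∩q∣ (true  ∷ p) (false ∷ q) = ∣q∣≡∣p∩q∣+∣∁p∩q∣ p q
∣q∣≡∣p∩q∣+∣∁p∩q∣ (false ∷ p) (false ∷ q) = ∣q∣≡∣p∩q∣+∣∁p∩q∣ p q

Empty⇒∣p∣≡0 : ∀ {n} {p : Subset n} → Empty p → ∣ p ∣ ≡ 0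
Empty⇒∣p∣≡0 {n} p-empty = trans (cong ∣_∣ (Empty-unique p-empty)) (∣⊥∣≡0 n)

∣p∣≡0⇒Empty : ∀ {n} {p : Subset n} → ∣ p ∣ ≡ 0 → Empty p
∣p∣≡0⇒Empty ∣p∣≡0 (x , x∈p) = <-irrefl (≡.sym ∣p∣≡0) (≤-<-trans z≤n (x∈p⇒∣p-x∣<∣p∣ x∈p))

module _ {n} (G : Graph n) where

  ∈N⁺ : ∀ {u v} → Adj G u v → v ∈ N G u
  ∈N⁺ {u} {v} adj =
    lookup⇒[]= v (N G u) (trans (lookup∘tabulate _ v) (dec-true (adj? G u v) adj))

  ∈N⁻ : ∀ {u v} → v ∈ N G u → Adj G u v
  ∈N⁻ {u} {v} v∈N with adj? G u v | trans (≡.sym (lookup∘tabulate _ v)) ([]=⇒lookup v∈N)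
  ... | yes adj | _ = adj
  ... | no _    | ()

  -- In a complete multipartite graph this is the part containing u.
  Part : Fin n → Subset n
  Part u = ∁ (N G u)

  ∈Part⁺ : ∀ {u v} → ¬ Adj G u v → v ∈ Part u
  ∈Part⁺ ¬adj = x∉p⇒x∈∁p (¬adj ∘ ∈N⁻)

  ∈Part⁻ : ∀ {u v} → v ∈ Part u → ¬ Adj G u v
  ∈Part⁻ v∈Part = x∈∁p⇒x∉p v∈Part ∘ ∈N⁺

  ∣p∣≡∣N∩p∣+∣Part∩p∣ : ∀ u p → ∣ p ∣ ≡ ∣ N G u ∩ p ∣ + ∣ Part u ∩ p ∣
  ∣p∣≡∣N∩p∣+∣Part∩p∣ u = ∣q∣≡∣p∩q∣+∣∁p∩q∣ (N G u)

  PartwiseExcess : ℕ → Subset n → Subset n → Set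
  PartwiseExcess c X Y = ∀ {u} → u ∈ Y → ∣ Part u ∩ Y ∣ + c ≤ ∣ Part u ∩ X ∣

module CompleteMultipartite {n} (G : Graph n) (multipartite : IsCompleteMultipartite G) where

  adj-resp-¬adj : ∀ {u u′ v v′} → ¬ Adj G u u′ → ¬ Adj G v v′ → Adj G u v → Adj G u′ v′
  adj-resp-¬adj {u} {u′} {v} {v′} ¬uu′ ¬vv′ adj = proj₂ (iff u′ v′) λ eq →
    proj₁ (iff u v) adj (trans (same-part ¬uu′) (trans eq (≡.sym (same-part ¬vv′))))
    where
    part = proj₁ multipartite
    iff = proj₂ multipartite
    same-part : ∀ {x y} → ¬ Adj G x y → part x ≡ part y
    same-part {x} {y} ¬adj = decidable-stable (part x ≟ part y) (¬adj ∘ proj₂ (iff x y))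

  PartwiseExcess-N∩ : ∀ {c X Y u₀} → PartwiseExcess G c X Y →
    PartwiseExcess G c (N G u₀ ∩ X) (N G u₀ ∩ Y)
  PartwiseExcess-N∩ {c} {X} {Y} {u₀} excess {u} u∈N∩Y with x∈p∩q⁻ _ _ u∈N∩Y
  ... | u∈N , u∈Y = begin
    ∣ Part G u ∩ (N G u₀ ∩ Y) ∣ + c  ≤⟨ +-monoˡ-≤ c (p⊆q⇒∣p∣≤∣q∣ forget-N) ⟩
    ∣ Part G u ∩ Y ∣ + c             ≤⟨ excess u∈Y ⟩
    ∣ Part G u ∩ X ∣                 ≤⟨ p⊆q⇒∣p∣≤∣q∣ add-N ⟩
    ∣ Part G u ∩ (N G u₀ ∩ X) ∣      ∎
    where
    open ≤-Reasoning
    forget-N : Part G u ∩ (N G u₀ ∩ Y) ⊆ Part G u ∩ Y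
    forget-N v∈ with x∈p∩q⁻ _ _ v∈
    ... | v∈Part , v∈N∩Y = x∈p∩q⁺ (v∈Part , p∩q⊆q _ _ v∈N∩Y)
    add-N : Part G u ∩ X ⊆ Part G u ∩ (N G u₀ ∩ X)
    add-N v∈ with x∈p∩q⁻ _ _ v∈
    ... | v∈Part , v∈X = x∈p∩q⁺ (v∈Part , x∈p∩q⁺
      (∈N⁺ G (adj-resp-¬adj (irrefl G) (∈Part⁻ G v∈Part) (∈N⁻ G u∈N)) , v∈X))

  PartwiseExcess⇒∣Y∣+c≤∣X∣ : ∀ {c X Y u₀} → PartwiseExcess G c X Y → u₀ ∈ Y → ∣ Y ∣ + c ≤ ∣ X ∣
  PartwiseExcess⇒∣Y∣+c≤∣X∣ = go (<-wellFounded _)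
    where
    go : ∀ {c X Y u₀} → Acc _<_ ∣ Y ∣ → PartwiseExcess G c X Y → u₀ ∈ Y → ∣ Y ∣ + c ≤ ∣ X ∣
    go {c} {X} {Y} {u₀} (acc smaller) excess u₀∈Y = begin
      ∣ Y ∣ + c                                          ≡⟨ cong (_+ c) (∣p∣≡∣N∩p∣+∣Part∩p∣ G u₀ Y) ⟩
      (∣ N G u₀ ∩ Y ∣ + ∣ Part G u₀ ∩ Y ∣) + c           ≡⟨ +-assoc ∣ N G u₀ ∩ Y ∣ _ c ⟩
      ∣ N G u₀ ∩ Y ∣ + (∣ Part G u₀ ∩ Y ∣ + c)           ≤⟨ +-mono-≤ other-parts (excess u₀∈Y) ⟩
      ∣ N G u₀ ∩ X ∣ + ∣ Part G u₀ ∩ X ∣                 ≡⟨ ≡.sym (∣p∣≡∣N∩p∣+∣Part∩p∣ G u₀ X) ⟩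
      ∣ X ∣                                              ∎
      where
      open ≤-Reasoning
      N∩Y⊂Y : N G u₀ ∩ Y ⊂ Y
      N∩Y⊂Y = p∩q⊆q _ _ , u₀ , u₀∈Y , irrefl G ∘ ∈N⁻ G ∘ proj₁ ∘ x∈p∩q⁻ _ _
      other-parts : ∣ N G u₀ ∩ Y ∣ ≤ ∣ N G u₀ ∩ X ∣
      other-parts with nonempty? (N G u₀ ∩ Y)
      ... | yes (_ , u₁∈) =
        m+n≤o⇒m≤o _ (go (smaller (p⊂q⇒∣p∣<∣q∣ N∩Y⊂Y)) (PartwiseExcess-N∩ excess) u₁∈)
      ... | no ∅          = subst (_≤ _) (≡.sym (Empty⇒∣p∣≡0 ∅)) z≤n

  fewer-neighbours⇒PartwiseExcess : ∀ k {c X Y} → ∣ Y ∣ + c ≡ ∣ X ∣ →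
    (∀ {u} → u ∈ Y → k + ∣ N G u ∩ X ∣ ≤ ∣ N G u ∩ Y ∣) → PartwiseExcess G (k + c) X Y
  fewer-neighbours⇒PartwiseExcess k {c} {X} {Y} ∣Y∣+c≡∣X∣ fewer {u} u∈Y =
    +-cancelˡ-≤ dX _ _ (begin
      dX + (eY + (k + c))  ≡⟨ solve 4 (λ dX eY k c → dX :+ (eY :+ (k :+ c)) := ((k :+ dX) :+ eY) :+ c)
                                      refl dX eY k c ⟩
      (k + dX + eY) + c    ≤⟨ +-monoˡ-≤ c (+-monoˡ-≤ eY (fewer u∈Y)) ⟩
      (dY + eY) + c        ≡⟨ cong (_+ c) (≡.sym (∣p∣≡∣N∩p∣+∣Part∩p∣ G u Y)) ⟩
      ∣ Y ∣ + c            ≡⟨ ∣Y∣+c≡∣X∣ ⟩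
      ∣ X ∣                ≡⟨ ∣p∣≡∣N∩p∣+∣Part∩p∣ G u X ⟩
      dX + eX              ∎)
    where
    open ≤-Reasoning
    open +-*-Solver
    dX = ∣ N G u ∩ X ∣
    dY = ∣ N G u ∩ Y ∣
    eX = ∣ Part G u ∩ X ∣
    eY = ∣ Part G u ∩ Y ∣

  ∃∣N∩Y∣≤∣N∩X∣ : ∀ {c X Y} → ∣ Y ∣ + c ≡ ∣ X ∣ → Nonempty Y →
    ∃ λ u → u ∈ Y × ∣ N G u ∩ Y ∣ ≤ ∣ N G u ∩ X ∣
  ∃∣N∩Y∣≤∣N∩X∣ {c} {X} {Y} ∣Y∣+c≡∣X∣ (u₀ , u₀∈Y)
    with any? (λ u → u ∈? Y ×-dec ∣ N G u ∩ Y ∣ ≤? ∣ N G u ∩ X ∣)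
  ... | yes witness = witness
  ... | no ∄ = ⊥-elim (1+n≰n (+-cancelˡ-≤ ∣ Y ∣ _ _
                (≤-trans (PartwiseExcess⇒∣Y∣+c≤∣X∣ excess u₀∈Y) (≤-reflexive (≡.sym ∣Y∣+c≡∣X∣)))))
    where
    excess : PartwiseExcess G (1 + c) X Y
    excess = fewer-neighbours⇒PartwiseExcess 1 ∣Y∣+c≡∣X∣ λ u∈Y → ≰⇒> λ le → ∄ (_ , u∈Y , le)

  ∪-Independent : ∀ {c X Y u₀} → ∣ Y ∣ + suc c ≡ ∣ X ∣ →
    (∀ {u} → u ∈ Y → ∣ N G u ∩ X ∣ ≤ ∣ N G u ∩ Y ∣) → u₀ ∈ Y → Independent G (X ∪ Y)
  ∪-Independent {c} {X} {Y} {u₀} ∣Y∣+c≡∣X∣ not-more u₀∈Y u v u∈ v∈ adj =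
    irrefl G (adj-resp-¬adj (¬adj-u₀ u∈ ∘ sym G) (¬adj-u₀ v∈ ∘ sym G) adj)
    where
    excess : PartwiseExcess G (suc c) X Y
    excess = fewer-neighbours⇒PartwiseExcess 0 ∣Y∣+c≡∣X∣ not-more
    -- The parts other than that of u₀ would give N u₀ ∩ X a surplus of suc c over N u₀ ∩ Y.
    N∩Y-empty : Empty (N G u₀ ∩ Y)
    N∩Y-empty (_ , u₁∈) = m+1+n≰m _
      (≤-trans (PartwiseExcess⇒∣Y∣+c≤∣X∣ (PartwiseExcess-N∩ excess) u₁∈) (not-more u₀∈Y))
    N∩X-empty : Empty (N G u₀ ∩ X)
    N∩X-empty = ∣p∣≡0⇒Empty (n≤0⇒n≡0 (subst (_ ≤_) (Empty⇒∣p∣≡0 N∩Y-empty) (not-more u₀∈Y)))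
    ¬adj-u₀ : ∀ {w} → w ∈ X ∪ Y → ¬ Adj G u₀ w
    ¬adj-u₀ w∈ adj with x∈p∪q⁻ X Y w∈
    ... | inj₁ w∈X = N∩X-empty (_ , x∈p∩q⁺ (∈N⁺ G adj , w∈X))
    ... | inj₂ w∈Y = N∩Y-empty (_ , x∈p∩q⁺ (∈N⁺ G adj , w∈Y))

  Part∩Y-nonempty : ∀ {c X Y u₀ v} → ∣ Y ∣ + c ≡ ∣ X ∣ →
    (∀ {u} → u ∈ Y → ∣ N G u ∩ X ∣ ≤ ∣ N G u ∩ Y ∣) → u₀ ∈ Y → v ∈ X → Nonempty (Part G v ∩ Y)
  Part∩Y-nonempty {c} {X} {Y} {v = v} ∣Y∣+c≡∣X∣ not-more u₀∈Y v∈X with nonempty? (Part G v ∩ Y)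
  ... | yes nonempty = nonempty
  ... | no ∅ = ⊥-elim (<-irrefl ∣Y∣+c≡∣X∣
                 (≤-<-trans (PartwiseExcess⇒∣Y∣+c≤∣X∣ excess-without-v u₀∈Y) (x∈p⇒∣p-x∣<∣p∣ v∈X)))
    where
    -- As the part of v misses Y, deleting v from X changes no part meeting Y.
    excess-without-v : PartwiseExcess G c (X - v) Y
    excess-without-v {u} u∈Y = ≤-trans (fewer-neighbours⇒PartwiseExcess 0 ∣Y∣+c≡∣X∣ not-more u∈Y)
      (p⊆q⇒∣p∣≤∣q∣ v∉Part)
      where
      v∉Part : Part G u ∩ X ⊆ Part G u ∩ (X - v)
      v∉Part w∈ with x∈p∩q⁻ _ _ w∈
      ... | w∈Part , w∈X = x∈p∩q⁺ (w∈Part , x∈p∧x≢y⇒x∈p-y w∈X λ { refl →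
        ∅ (u , x∈p∩q⁺ (∈Part⁺ G (∈Part⁻ G w∈Part ∘ sym G) , u∈Y)) })

  Colourable-cover : ∀ {S T k} → (∀ {v} → v ∈ T → Nonempty (Part G v ∩ S)) →
    Colourable G S k → Colourable G T k
  Colourable-cover {S} {T} cover (colour , proper) = colour ∘ rep , proper′
    where
    rep : Fin n → Fin n
    rep v with nonempty? (Part G v ∩ S)
    ... | yes (w , _) = w
    ... | no _        = v

    rep∈Part∩S : ∀ {v} → v ∈ T → rep v ∈ Part G v ∩ S
    rep∈Part∩S {v} v∈T with nonempty? (Part G v ∩ S)
    ... | yes (_ , w∈) = w∈
    ... | no ∅         = ⊥-elim (∅ (cover v∈T))

    proper′ : ∀ u v → u ∈ T → v ∈ T → Adj G u v → colour (rep u) ≢ colour (rep v)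
    proper′ u v u∈T v∈T adj with x∈p∩q⁻ _ _ (rep∈Part∩S u∈T) | x∈p∩q⁻ _ _ (rep∈Part∩S v∈T)
    ... | ru∈Part , ru∈S | rv∈Part , rv∈S =
      proper (rep u) (rep v) ru∈S rv∈S (adj-resp-¬adj (∈Part⁻ G ru∈Part) (∈Part⁻ G rv∈Part) adj)

  ¬ChromaticLess : ∀ {S T} → (∀ {v} → v ∈ T → Nonempty (Part G v ∩ S)) → ¬ ChromaticLess G S T
  ¬ChromaticLess cover (a , b , (colourable , _) , (_ , minimal) , a<b) =
    <⇒≱ a<b (minimal a (Colourable-cover cover colourable))

lemma3p1 : ∀ {n} (G : Graph n) → IsCompleteMultipartite G →
    (V₁ V₂ : Subset n) → Empty (V₁ ∩ V₂) → Nonempty V₂ →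
    ∣ V₂ ∣ ≤ ∣ V₁ ∣ → ¬ Independent G (V₁ ∪ V₂) →
    (∃ λ u → u ∈ V₂ × ∣ N G u ∩ V₂ ∣ ≤ ∣ N G u ∩ V₁ ∣)
    × ((∣ V₂ ∣ < ∣ V₁ ∣ ⊎ ChromaticLess G V₂ (V₁ ∪ V₂)) →
    ∃ λ u → u ∈ V₂ × ∣ N G u ∩ V₂ ∣ < ∣ N G u ∩ V₁ ∣)
-- The argument never uses that V₁ and V₂ are disjoint.
lemma3p1 G multipartite V₁ V₂ _ (u₀ , u₀∈V₂) ∣V₂∣≤∣V₁∣ dependent
  with m≤n⇒∃[o]m+o≡n ∣V₂∣≤∣V₁∣
... | c , ∣V₂∣+c≡∣V₁∣ = ∃∣N∩Y∣≤∣N∩X∣ ∣V₂∣+c≡∣V₁∣ (u₀ , u₀∈V₂) , strict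
  where
  open CompleteMultipartite G multipartite
  strict : ∣ V₂ ∣ < ∣ V₁ ∣ ⊎ ChromaticLess G V₂ (V₁ ∪ V₂) →
    ∃ λ u → u ∈ V₂ × ∣ N G u ∩ V₂ ∣ < ∣ N G u ∩ V₁ ∣
  strict hypothesis with any? (λ u → u ∈? V₂ ×-dec ∣ N G u ∩ V₂ ∣ <? ∣ N G u ∩ V₁ ∣)
  ... | yes witness = witness
  ... | no ∄ = ⊥-elim (refute c ∣V₂∣+c≡∣V₁∣ hypothesis)
    where
    not-more : ∀ {u} → u ∈ V₂ → ∣ N G u ∩ V₁ ∣ ≤ ∣ N G u ∩ V₂ ∣
    not-more u∈V₂ = ≮⇒≥ λ lt → ∄ (_ , u∈V₂ , lt)
    refute : ∀ c → ∣ V₂ ∣ + c ≡ ∣ V₁ ∣ → ∣ V₂ ∣ < ∣ V₁ ∣ ⊎ ChromaticLess G V₂ (V₁ ∪ V₂) → ⊥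
    refute (suc c) eq _          = dependent (∪-Independent eq not-more u₀∈V₂)
    refute zero    eq (inj₁ lt)  = <-irrefl (trans (≡.sym (+-identityʳ _)) eq) lt
    refute zero    eq (inj₂ χ<)  = ¬ChromaticLess cover χ<
      where
      cover : ∀ {v} → v ∈ V₁ ∪ V₂ → Nonempty (Part G v ∩ V₂)
      cover v∈ with x∈p∪q⁻ V₁ V₂ v∈
      ... | inj₁ v∈V₁ = Part∩Y-nonempty eq not-more u₀∈V₂ v∈V₁
      ... | inj₂ v∈V₂ = _ , x∈p∩q⁺ (∈Part⁺ G (irrefl G) , v∈V₂)
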